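{- For every $n\ge 32$, let $f_7\colon\{0,1\}^n\to\{0,1,\perp\}$ be given by $f_7(x)=0$ if $|x|\le 7$, $f_7(x)=\perp$ if $8\le|x|\le n-1$, $f_7(x)=1$ if $|x|=n$, and $F_7(x,y)=f_7(x\oplus y)$. Then $\mathrm{D_{cc}^{\rightarrow}}(F_7)\le 7$, whereas $\mathrm{NADT^{\oplus}}(f_7)=8$.
   Context: $|x|$ is Hamming weight, $\oplus$ is bitwise XOR. $\operatorname{Dom}(f)=f^{ -1}(\{0,1\})$, $\operatorname{Dom}(F)=\{(x,y):x\oplus y\in\operatorname{Dom}(f)\}$. $\mathrm{D_{cc}^{\rightarrow}}(F)$ is the minimum $t$ such that there are total $h\colon\{0,1\}^n\to\{0,1\}^t$ and $\varphi\colon\{0,1\}^t\times\{0,1\}^n\to\{0,1\}$ with $\varphi(h(x),y)=F(x,y)$ for all $(x,y)\in\operatorname{Dom}(F)$. With $\langle s,x\rangle=\bigoplus_is_i\wedge x_i$, $\mathrm{NADT^{\oplus}}(f)$ is the minimum $p$ such that there are $s_1,\dots,s_p\in\{0,1\}^n$ and total $l\colon\{0,1\}^p\to\{0,1\}$ with $l(\langle s_1,x\rangle,\dots,\langle s_p,x\rangle)=f(x)$ for all $x\in\operatorname{Dom}(f)$. -}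

module Defs where

open import Data.Nat using (ℕ; zero; suc; _+_; _≤_; _<_; _≤?_; _≟_)
open import Data.Bool using (Bool; true; false; _xor_; _∧_; if_then_else_)
open import Data.Vec using (Vec; []; _∷_; zipWith)
open import Data.Maybe using (Maybe; just; nothing)
open import Data.Product using (Σ; _×_; ∃)
open import Relation.Nullary.Decidable using (⌊_⌋)
open import Relation.Binary.PropositionalEquality using (_≡_)

BitStr : ℕ → Set
BitStr n = Vec Bool n

-- Partial Boolean function {0,1}^n → {0,1,⊥}; ⊥ is represented by nothing.
-- Dom(f) = { x | f x ≡ just b for some b }.
PartialFn : ℕ → Set
PartialFn n = BitStr n → Maybe Bool

PartialFn₂ : ℕ → Set
PartialFn₂ n = BitStr n → BitStr n → Maybe Bool

weight : ∀ {n} → BitStr n → ℕ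
weight [] = 0
weight (true ∷ xs) = suc (weight xs)
weight (false ∷ xs) = weight xs

_⊕_ : ∀ {n} → BitStr n → BitStr n → BitStr n
_⊕_ = zipWith _xor_

ip : ∀ {n} → BitStr n → BitStr n → Bool
ip [] [] = false
ip (s ∷ ss) (x ∷ xs) = (s ∧ x) xor ip ss xs

xorLift : ∀ {n} → PartialFn n → PartialFn₂ n
xorLift f x y = f (x ⊕ y)

-- f_7 : 0 if |x| ≤ 7, 1 if |x| = n, ⊥ otherwise (for n ≥ 32 the cases are disjoint).
f7 : (n : ℕ) → PartialFn n
f7 n x = if ⌊ weight x ≤? 7 ⌋ then just false
         else (if ⌊ weight x ≟ n ⌋ then just true else nothing)

F7 : (n : ℕ) → PartialFn₂ n
F7 n = xorLift (f7 n)

OneWayProtocol : ∀ {n} → PartialFn₂ n → ℕ → Set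
OneWayProtocol {n} F t =
  Σ (BitStr n → BitStr t) λ h →
  Σ (BitStr t → BitStr n → Bool) λ φ →
    ∀ x y b → F x y ≡ just b → φ (h x) y ≡ b

Dcc≤ : ∀ {n} → PartialFn₂ n → ℕ → Set
Dcc≤ F k = ∃ λ t → t ≤ k × OneWayProtocol F t

NADTxor : ∀ {n} → PartialFn n → ℕ → Set
NADTxor {n} f p =
  Σ (Vec (BitStr n) p) λ ss →
  Σ (BitStr p → Bool) λ l →
    ∀ x b → f x ≡ just b → l (Data.Vec.map (λ s → ip s x) ss) ≡ b

NADTxor≡ : ∀ {n} → PartialFn n → ℕ → Set
NADTxor≡ f p = NADTxor f p × (∀ q → NADTxor f q → p ≤ q)

-- Upper bound: Alice sends the Hamming [7,4] decoding of x₁…x₇ together with x₈x₉x₁₀, and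
-- Bob accepts iff this equals the same message computed from the complement of y.  The code
-- has covering radius 1, so equal decodings put x₁…x₇ within distance 2 of ¬y₁…¬y₇, i.e. at
-- distance ≥ 5 from y₁…y₇; a false acceptance thus needs |x ⊕ y| ≥ 5 + 3 = 8.
-- Lower bound: parities are linear, so every x gets the same answers to q parity queries as
-- some z of weight ≤ q.  For q ≤ 7 this makes 1ⁿ indistinguishable from a 0-input of f₇,
-- while reading eight coordinates shows that 8 queries suffice.
module Submission where

open import Defs
open import Data.Nat using (ℕ; _≤_)
open import Data.Product using (_×_)

open import Algebra using (CommutativeRing)
open import Data.Bool using (true; false; _xor_; _∧_; not; if_then_else_)
open import Data.Bool.Properties
  using (xor-∧-commutativeRing; xor-identityʳ; xor-same; xor-assoc; xor-comm; xor-inverseˡ;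
         not-distribʳ-xor; ∧-distribˡ-xor; ∧-distribʳ-xor; ¬-not)
  renaming (_≟_ to _≟ᵇ_)
open import Algebra.Properties.CommutativeSemigroup
  (CommutativeRing.+-commutativeSemigroup xor-∧-commutativeRing)
  using (interchange)
open import Data.Empty using (⊥; ⊥-elim)
open import Data.Maybe using (just)
open import Data.Nat using (zero; suc; z≤n; s≤s; _+_; _≤?_; _≟_)
open import Data.Nat.Properties
  using (≤-refl; ≤-trans; ≤-reflexive; ≤-pred; +-comm; +-suc; +-mono-≤; +-monoʳ-≤;
         +-cancelˡ-≤; m≤m+n; m≤n⇒m≤1+n; n≤1+n; 1+n≰n; <⇒≱; ≮⇒≥; suc-injective;
         m≤n⇒∃[o]m+o≡n; module ≤-Reasoning)
open import Data.Product using (_,_; ∃; proj₁; proj₂)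
open import Data.Sum using (_⊎_; inj₁; inj₂)
open import Data.Vec using (Vec; []; _∷_; _++_; map; replicate; take; drop)
open import Data.Vec.Properties
  using (∷-injective; ++-injective; map-∘; take-map; drop-map; take-zipWith; drop-zipWith;
         take++drop≡id; ≡-dec)
open import Data.Vec.Relation.Unary.All as All using (All; []; _∷_)
import Data.Vec.Relation.Unary.All.Properties as Allₚ
open import Function using (id)
open import Relation.Nullary using (Dec; does; yes; no)
open import Relation.Nullary.Decidable using (map′; _×-dec_; from-yes; dec-true; dec-false)
open import Relation.Binary.PropositionalEquality
  using (_≡_; refl; sym; trans; cong; cong₂; subst; module ≡-Reasoning)

ones zeros : ∀ m → BitStr m
ones m = replicate m true
zeros m = replicate m false

neg : ∀ {m} → BitStr m → BitStr m
neg = map not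

weight-ones : ∀ m → weight (ones m) ≡ m
weight-ones zero = refl
weight-ones (suc m) = cong suc (weight-ones m)

weight-zeros : ∀ m → weight (zeros m) ≡ 0
weight-zeros zero = refl
weight-zeros (suc m) = weight-zeros m

weight≤length : ∀ {m} (v : BitStr m) → weight v ≤ m
weight≤length [] = z≤n
weight≤length (true ∷ v) = s≤s (weight≤length v)
weight≤length (false ∷ v) = m≤n⇒m≤1+n (weight≤length v)

weight≡length⇒ones : ∀ {m} (v : BitStr m) → weight v ≡ m → v ≡ ones m
weight≡length⇒ones [] _ = refl
weight≡length⇒ones (true ∷ v) w = cong (true ∷_) (weight≡length⇒ones v (suc-injective w))
weight≡length⇒ones (false ∷ v) w = ⊥-elim (1+n≰n (subst (_≤ _) w (weight≤length v)))

weight-++ : ∀ {k l} (a : BitStr k) (b : BitStr l) → weight (a ++ b) ≡ weight a + weight b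
weight-++ [] b = refl
weight-++ (true ∷ a) b = cong suc (weight-++ a b)
weight-++ (false ∷ a) b = weight-++ a b

weight-take+drop : ∀ k {l} (v : BitStr (k + l)) → weight v ≡ weight (take k v) + weight (drop k v)
weight-take+drop k v = trans (cong weight (sym (take++drop≡id k v))) (weight-++ (take k v) (drop k v))

weight-take≤ : ∀ k {l} (v : BitStr (k + l)) → weight (take k v) ≤ weight v
weight-take≤ k v = subst (weight (take k v) ≤_) (sym (weight-take+drop k v)) (m≤m+n _ _)

weight-neg : ∀ {m} (v : BitStr m) → weight (neg v) + weight v ≡ m
weight-neg [] = refl
weight-neg (true ∷ v) = trans (+-suc _ _) (cong suc (weight-neg v))
weight-neg (false ∷ v) = cong suc (weight-neg v)

weight-⊕≤ : ∀ {m} (a b : BitStr m) → weight (a ⊕ b) ≤ weight a + weight b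
weight-⊕≤ [] [] = z≤n
weight-⊕≤ (true ∷ a) (true ∷ b) =
  ≤-trans (weight-⊕≤ a b) (m≤n⇒m≤1+n (+-monoʳ-≤ (weight a) (n≤1+n _)))
weight-⊕≤ (true ∷ a) (false ∷ b) = s≤s (weight-⊕≤ a b)
weight-⊕≤ (false ∷ a) (true ∷ b) =
  subst (suc (weight (a ⊕ b)) ≤_) (sym (+-suc (weight a) (weight b))) (s≤s (weight-⊕≤ a b))
weight-⊕≤ (false ∷ a) (false ∷ b) = weight-⊕≤ a b

⊕-neg : ∀ {m} (a b : BitStr m) → a ⊕ neg b ≡ neg (a ⊕ b)
⊕-neg [] [] = refl
⊕-neg (a ∷ as) (b ∷ bs) = cong₂ _∷_ (sym (not-distribʳ-xor a b)) (⊕-neg as bs)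

neg-⊕ : ∀ {m} (a : BitStr m) → neg a ⊕ a ≡ ones m
neg-⊕ [] = refl
neg-⊕ (a ∷ as) = cong₂ _∷_ (xor-inverseˡ a) (neg-⊕ as)

⊕≡ones⇒≡neg : ∀ {m} (a b : BitStr m) → a ⊕ b ≡ ones m → a ≡ neg b
⊕≡ones⇒≡neg [] [] _ = refl
⊕≡ones⇒≡neg (a ∷ as) (b ∷ bs) e =
  cong₂ _∷_ (xor≡true⇒≡not a b (proj₁ (∷-injective e))) (⊕≡ones⇒≡neg as bs (proj₂ (∷-injective e)))
  where
  xor≡true⇒≡not : ∀ a b → (a xor b) ≡ true → a ≡ not b
  xor≡true⇒≡not true false _ = refl
  xor≡true⇒≡not false true _ = refl

⊕-cancel-common : ∀ {m} (a c e : BitStr m) → (a ⊕ e) ⊕ (c ⊕ e) ≡ a ⊕ c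
⊕-cancel-common [] [] [] = refl
⊕-cancel-common (a ∷ as) (c ∷ cs) (e ∷ es) = cong₂ _∷_ cancel (⊕-cancel-common as cs es)
  where
  open ≡-Reasoning
  cancel : (a xor e) xor (c xor e) ≡ a xor c
  cancel = begin
    (a xor e) xor (c xor e) ≡⟨ interchange a e c e ⟩
    (a xor c) xor (e xor e) ≡⟨ cong ((a xor c) xor_) (xor-same e) ⟩
    (a xor c) xor false     ≡⟨ xor-identityʳ _ ⟩
    a xor c                 ∎

weight-⊕-triangle : ∀ {m} (a c e : BitStr m) → weight (a ⊕ c) ≤ weight (a ⊕ e) + weight (c ⊕ e)
weight-⊕-triangle a c e =
  subst (λ v → weight v ≤ weight (a ⊕ e) + weight (c ⊕ e)) (⊕-cancel-common a c e)
        (weight-⊕≤ (a ⊕ e) (c ⊕ e))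

ip-zerosˡ : ∀ {m} (v : BitStr m) → ip (zeros m) v ≡ false
ip-zerosˡ [] = refl
ip-zerosˡ (_ ∷ v) = ip-zerosˡ v

ip-zerosʳ : ∀ {m} (v : BitStr m) → ip v (zeros m) ≡ false
ip-zerosʳ [] = refl
ip-zerosʳ (true ∷ v) = ip-zerosʳ v
ip-zerosʳ (false ∷ v) = ip-zerosʳ v

ip-⊕ˡ : ∀ {m} (s t y : BitStr m) → ip (s ⊕ t) y ≡ ip s y xor ip t y
ip-⊕ˡ [] [] [] = refl
ip-⊕ˡ (s ∷ ss) (t ∷ ts) (y ∷ ys) =
  trans (cong₂ _xor_ (∧-distribʳ-xor y s t) (ip-⊕ˡ ss ts ys))
        (interchange (s ∧ y) (t ∧ y) (ip ss ys) (ip ts ys))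

ip-⊕ʳ : ∀ {m} (s y z : BitStr m) → ip s (y ⊕ z) ≡ ip s y xor ip s z
ip-⊕ʳ [] [] [] = refl
ip-⊕ʳ (s ∷ ss) (y ∷ ys) (z ∷ zs) =
  trans (cong₂ _xor_ (∧-distribˡ-xor s y z) (ip-⊕ʳ ss ys zs))
        (interchange (s ∧ y) (s ∧ z) (ip ss ys) (ip ss zs))

f7-light : ∀ n (z : BitStr n) → weight z ≤ 7 → f7 n z ≡ just false
f7-light n z light with weight z ≤? 7
... | yes _ = refl
... | no heavy = ⊥-elim (heavy light)

f7-ones : ∀ {n} → 8 ≤ n → f7 n (ones n) ≡ just true
f7-ones {n} 8≤n with weight (ones n) ≤? 7 | weight (ones n) ≟ n
... | yes light | _ = ⊥-elim (<⇒≱ 8≤n (subst (_≤ 7) (weight-ones n) light))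
... | no _ | yes _ = refl
... | no _ | no ¬full = ⊥-elim (¬full (weight-ones n))

f7-false-inv : ∀ n (z : BitStr n) → f7 n z ≡ just false → weight z ≤ 7
f7-false-inv n z eq with weight z ≤? 7 | weight z ≟ n
f7-false-inv n z eq | yes light | _ = light
f7-false-inv n z () | no _ | yes _
f7-false-inv n z () | no _ | no _

f7-true-inv : ∀ n (z : BitStr n) → f7 n z ≡ just true → z ≡ ones n
f7-true-inv n z eq with weight z ≤? 7 | weight z ≟ n
f7-true-inv n z () | yes _ | _
f7-true-inv n z eq | no _ | yes full = weight≡length⇒ones z full
f7-true-inv n z () | no _ | no _

-- The Hamming [7,4] code, parity bits at positions 1, 2, 4.  The syndrome s₄s₂s₁ spells
-- the position of a single error, and decode corrects the data bit at that position.
encode : BitStr 4 → BitStr 7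
encode (d₃ ∷ d₅ ∷ d₆ ∷ d₇ ∷ []) =
  (d₃ xor d₅ xor d₇) ∷ (d₃ xor d₆ xor d₇) ∷ d₃ ∷ (d₅ xor d₆ xor d₇) ∷ d₅ ∷ d₆ ∷ d₇ ∷ []

decode : BitStr 7 → BitStr 4
decode (a₁ ∷ a₂ ∷ a₃ ∷ a₄ ∷ a₅ ∷ a₆ ∷ a₇ ∷ []) =
  (a₃ xor (s₁ ∧ s₂ ∧ not s₄)) ∷ (a₅ xor (s₁ ∧ not s₂ ∧ s₄)) ∷
  (a₆ xor (not s₁ ∧ s₂ ∧ s₄)) ∷ (a₇ xor (s₁ ∧ s₂ ∧ s₄)) ∷ []
  where
  s₁ = a₁ xor a₃ xor a₅ xor a₇
  s₂ = a₂ xor a₃ xor a₆ xor a₇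
  s₄ = a₄ xor a₅ xor a₆ xor a₇

all-BitStr? : ∀ m {P : BitStr m → Set} → (∀ v → Dec (P v)) → Dec (∀ v → P v)
all-BitStr? zero P? = map′ (λ p → λ { [] → p }) (λ p → p []) (P? [])
all-BitStr? (suc m) P? =
  map′ (λ (p , q) → λ { (true ∷ v) → p v ; (false ∷ v) → q v })
       (λ p → (λ v → p (true ∷ v)) , (λ v → p (false ∷ v)))
       (all-BitStr? m (λ v → P? (true ∷ v)) ×-dec all-BitStr? m (λ v → P? (false ∷ v)))

decode-covering : ∀ a → weight (a ⊕ encode (decode a)) ≤ 1
decode-covering = from-yes (all-BitStr? 7 (λ a → weight (a ⊕ encode (decode a)) ≤? 1))

decode-collision : ∀ a b → decode a ≡ decode b → weight (a ⊕ b) ≤ 2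
decode-collision a b eq =
  ≤-trans (weight-⊕-triangle a b (encode (decode a)))
          (+-mono-≤ (decode-covering a)
                    (subst (λ c → weight (b ⊕ encode c) ≤ 1) (sym eq) (decode-covering b)))

-- Alice sends h x; Bob accepts iff it equals h (neg y).  A gap d rules out false
-- acceptance whenever x and y are at distance below d.
AntipodalGap : ∀ {n t} → (BitStr n → BitStr t) → ℕ → Set
AntipodalGap h d = ∀ x z → h x ≡ h (neg z) → d ≤ weight (x ⊕ z)

decode-gap : AntipodalGap decode 5
decode-gap x z eq = +-cancelˡ-≤ 2 5 (weight (x ⊕ z)) (begin
  7                                     ≡⟨ sym (weight-neg (x ⊕ z)) ⟩
  weight (neg (x ⊕ z)) + weight (x ⊕ z) ≤⟨ +-mono-≤ near ≤-refl ⟩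
  2 + weight (x ⊕ z)                    ∎)
  where
  open ≤-Reasoning
  near : weight (neg (x ⊕ z)) ≤ 2
  near = subst (λ v → weight v ≤ 2) (⊕-neg x z) (decode-collision x (neg z) eq)

id-gap : ∀ {l} → AntipodalGap {l} id l
id-gap {l} x z refl = ≤-reflexive (sym (trans (cong weight (neg-⊕ z)) (weight-ones l)))

const-gap : ∀ {l} → AntipodalGap {l} (λ _ → []) 0
const-gap _ _ _ = z≤n

infixr 5 _⊗_
_⊗_ : ∀ {k l s t} → (BitStr k → BitStr s) → (BitStr l → BitStr t) → BitStr (k + l) → BitStr (s + t)
(_⊗_ {k} h₁ h₂) x = h₁ (take k x) ++ h₂ (drop k x)

gap-⊗ : ∀ {k l s t d₁ d₂} {h₁ : BitStr k → BitStr s} {h₂ : BitStr l → BitStr t} →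
        AntipodalGap h₁ d₁ → AntipodalGap h₂ d₂ → AntipodalGap (h₁ ⊗ h₂) (d₁ + d₂)
gap-⊗ {k} {d₁ = d₁} {d₂} {h₁} {h₂} gap₁ gap₂ x z eq = begin
  d₁ + d₂
    ≤⟨ +-mono-≤ (gap₁ (take k x) (take k z) eq₁) (gap₂ (drop k x) (drop k z) eq₂) ⟩
  weight (take k x ⊕ take k z) + weight (drop k x ⊕ drop k z)
    ≡⟨ sym (cong₂ _+_ (cong weight (take-zipWith {m = k} _xor_ x z))
                      (cong weight (drop-zipWith {m = k} _xor_ x z))) ⟩
  weight (take k (x ⊕ z)) + weight (drop k (x ⊕ z))
    ≡⟨ sym (weight-take+drop k (x ⊕ z)) ⟩
  weight (x ⊕ z) ∎
  where
  open ≤-Reasoning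
  halves = ++-injective (h₁ (take k x)) (h₁ (take k (neg z))) eq
  eq₁ : h₁ (take k x) ≡ h₁ (neg (take k z))
  eq₁ = trans (proj₁ halves) (cong h₁ (take-map not k z))
  eq₂ : h₂ (drop k x) ≡ h₂ (neg (drop k z))
  eq₂ = trans (proj₂ halves) (cong h₂ (drop-map not k z))

hash : ∀ {m} → BitStr (7 + (3 + m)) → BitStr 7
hash = decode ⊗ id ⊗ (λ _ → [])

hash-gap : ∀ {m} → AntipodalGap (hash {m}) 8
hash-gap = gap-⊗ decode-gap (gap-⊗ id-gap const-gap)

gap⇒protocol : ∀ {n t} (h : BitStr n → BitStr t) → AntipodalGap h 8 → OneWayProtocol (F7 n) t
gap⇒protocol {n} h gap = h , (λ c y → does (≡-dec _≟ᵇ_ c (h (neg y)))) , correct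
  where
  correct : ∀ x y b → F7 n x y ≡ just b → does (≡-dec _≟ᵇ_ (h x) (h (neg y))) ≡ b
  correct x y false eq =
    dec-false (≡-dec _≟ᵇ_ (h x) (h (neg y)))
              (λ same → <⇒≱ (gap x y same) (f7-false-inv n (x ⊕ y) eq))
  correct x y true eq =
    dec-true (≡-dec _≟ᵇ_ (h x) (h (neg y)))
             (cong h (⊕≡ones⇒≡neg x y (f7-true-inv n (x ⊕ y) eq)))

answers : ∀ {n q} → Vec (BitStr n) q → BitStr n → BitStr q
answers ss x = map (λ s → ip s x) ss

prefix-queries : ∀ k {m} → Vec (BitStr (k + m)) k
prefix-queries zero = []
prefix-queries (suc k) = (true ∷ zeros _) ∷ map (false ∷_) (prefix-queries k)

answers-prefix-queries : ∀ k {m} (x : BitStr (k + m)) → answers (prefix-queries k) x ≡ take k x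
answers-prefix-queries zero x = refl
answers-prefix-queries (suc k) (b ∷ x) =
  cong₂ _∷_ (trans (cong (b xor_) (ip-zerosˡ x)) (xor-identityʳ b))
            (trans (sym (map-∘ _ _ (prefix-queries k))) (answers-prefix-queries k x))

f7-nadt-upper : ∀ m → NADTxor (f7 (8 + m)) 8
f7-nadt-upper m = prefix-queries 8 , (λ v → does (weight v ≟ 8)) , correct
  where
  correct : ∀ x b → f7 (8 + m) x ≡ just b → does (weight (answers (prefix-queries 8) x) ≟ 8) ≡ b
  correct x false eq rewrite answers-prefix-queries 8 x =
    dec-false (weight (take 8 x) ≟ 8)
              (λ full → <⇒≱ (≤-reflexive (sym full))
                                (≤-trans (weight-take≤ 8 x) (f7-false-inv _ x eq)))
  correct x true eq rewrite answers-prefix-queries 8 x | f7-true-inv _ x eq = refl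

clear : ∀ {n} → BitStr n → BitStr n → BitStr n → BitStr n
clear s u t = if ip t u then t ⊕ s else t

ip-clear : ∀ {n} (s u t y : BitStr n) → ip t y ≡ ip (clear s u t) y xor (ip t u ∧ ip s y)
ip-clear s u t y with ip t u
... | false = sym (xor-identityʳ (ip t y))
... | true = sym (begin
  ip (t ⊕ s) y xor ip s y          ≡⟨ cong (_xor ip s y) (ip-⊕ˡ t s y) ⟩
  (ip t y xor ip s y) xor ip s y   ≡⟨ xor-assoc (ip t y) (ip s y) (ip s y) ⟩
  ip t y xor (ip s y xor ip s y)   ≡⟨ cong (ip t y xor_) (xor-same (ip s y)) ⟩
  ip t y xor false                 ≡⟨ xor-identityʳ (ip t y) ⟩
  ip t y                           ∎)
  where open ≡-Reasoning

clear-orthogonal : ∀ {n} (s u t : BitStr n) → ip s u ≡ true → ip (clear s u t) u ≡ false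
clear-orthogonal s u t su with ip t u in tu
... | true = trans (ip-⊕ˡ t s u) (cong₂ _xor_ tu su)
... | false = tu

agree-clear : ∀ {n} (s u t : BitStr n) {z x} →
              ip s z ≡ ip s x → ip (clear s u t) z ≡ ip (clear s u t) x → ip t z ≡ ip t x
agree-clear s u t {z} {x} sz tz = begin
  ip t z                                   ≡⟨ ip-clear s u t z ⟩
  ip (clear s u t) z xor (ip t u ∧ ip s z) ≡⟨ cong₂ (λ a b → a xor (ip t u ∧ b)) tz sz ⟩
  ip (clear s u t) x xor (ip t u ∧ ip s x) ≡⟨ sym (ip-clear s u t x) ⟩
  ip t x                                   ∎
  where open ≡-Reasoning

ip-⊕-orthogonal : ∀ {n} (t y u : BitStr n) → ip t u ≡ false → ip t (y ⊕ u) ≡ ip t y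
ip-⊕-orthogonal t y u tu =
  trans (ip-⊕ʳ t y u) (trans (cong (ip t y xor_) tu) (xor-identityʳ (ip t y)))

zero-or-unit : ∀ {n} (s : BitStr n) →
               (∀ y → ip s y ≡ false) ⊎ ∃ λ u → weight u ≤ 1 × ip s u ≡ true
zero-or-unit [] = inj₁ λ { [] → refl }
zero-or-unit {suc n} (true ∷ s) =
  inj₂ (true ∷ zeros n , s≤s (≤-reflexive (weight-zeros n)) , cong not (ip-zerosʳ s))
zero-or-unit (false ∷ s) with zero-or-unit s
... | inj₁ s⊥ = inj₁ λ { (_ ∷ y) → s⊥ y }
... | inj₂ (u , wu , su) = inj₂ (false ∷ u , wu , su)

fix-parity : ∀ {n} (s u T x : BitStr n) → ip s u ≡ true →
             ∃ λ z → weight z ≤ weight T + weight u × ip s z ≡ ip s x ×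
                     (∀ t → ip t u ≡ false → ip t z ≡ ip t T)
fix-parity s u T x su with ip s T ≟ᵇ ip s x
... | yes same = T , m≤m+n _ _ , same , λ _ _ → refl
... | no differ = T ⊕ u , weight-⊕≤ T u , flipped , λ t tu → ip-⊕-orthogonal t T u tu
  where
  open ≡-Reasoning
  flipped : ip s (T ⊕ u) ≡ ip s x
  flipped = begin
    ip s (T ⊕ u)        ≡⟨ ip-⊕ʳ s T u ⟩
    ip s T xor ip s u   ≡⟨ cong (ip s T xor_) su ⟩
    ip s T xor true     ≡⟨ xor-comm (ip s T) true ⟩
    not (ip s T)        ≡⟨ sym (¬-not (λ e → differ (sym e))) ⟩
    ip s x              ∎

Indistinguishable : ∀ {n q} → Vec (BitStr n) q → BitStr n → BitStr n → Set
Indistinguishable ss z x = All (λ s → ip s z ≡ ip s x) ss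

indistinguishable⇒answers≡ : ∀ {n q} {ss : Vec (BitStr n) q} {z x} →
                             Indistinguishable ss z x → answers ss z ≡ answers ss x
indistinguishable⇒answers≡ [] = refl
indistinguishable⇒answers≡ (e ∷ es) = cong₂ _∷_ e (indistinguishable⇒answers≡ es)

-- Gaussian elimination: either the first query vanishes, or it is pivoted on a unit
-- vector u, the remaining queries are cleared against u, and induction runs on x ⊕ u.
sparse-indistinguishable : ∀ {n} q (ss : Vec (BitStr n) q) (x : BitStr n) →
                           ∃ λ z → weight z ≤ q × Indistinguishable ss z x
sparse-indistinguishable {n} zero [] x = zeros n , ≤-reflexive (weight-zeros n) , []
sparse-indistinguishable (suc q) (s ∷ ss) x with zero-or-unit s
... | inj₁ s⊥ with sparse-indistinguishable q ss x
...   | z , wz , agree = z , m≤n⇒m≤1+n wz , trans (s⊥ z) (sym (s⊥ x)) ∷ agree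
sparse-indistinguishable (suc q) (s ∷ ss) x | inj₂ (u , wu , su)
  with sparse-indistinguishable q (map (clear s u) ss) (x ⊕ u)
... | T , wT , agreeT with fix-parity s u T x su
...   | z , wz , sz , zT =
  z , ≤-trans wz (subst (weight T + weight u ≤_) (+-comm q 1) (+-mono-≤ wT wu)) ,
  sz ∷ All.map (λ {t} → agree-rest {t}) (Allₚ.map⁻ agreeT)
  where
  agree-rest : ∀ {t} → ip (clear s u t) T ≡ ip (clear s u t) (x ⊕ u) → ip t z ≡ ip t x
  agree-rest {t} tT =
    agree-clear s u t sz (trans (zT t′ orth) (trans tT (ip-⊕-orthogonal t′ x u orth)))
    where
    t′ = clear s u t
    orth = clear-orthogonal s u t su

f7-nadt-lower : ∀ {n} → 8 ≤ n → ∀ q → NADTxor (f7 n) q → 8 ≤ q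
f7-nadt-lower {n} 8≤n q (ss , l , computes) with sparse-indistinguishable q ss (ones n)
... | z , wz , agree = ≮⇒≥ λ q<8 → false≢true (begin
  false                   ≡⟨ sym (computes z false (f7-light n z (≤-pred (≤-trans (s≤s wz) q<8)))) ⟩
  l (answers ss z)        ≡⟨ cong l (indistinguishable⇒answers≡ agree) ⟩
  l (answers ss (ones n)) ≡⟨ computes (ones n) true (f7-ones 8≤n) ⟩
  true                    ∎)
  where
  open ≡-Reasoning
  false≢true : false ≡ true → ⊥
  false≢true ()

f7-separation : ∀ k → Dcc≤ (F7 (32 + k)) 7 × NADTxor≡ (f7 (32 + k)) 8
f7-separation k =
  (7 , ≤-refl , gap⇒protocol hash hash-gap) ,
  f7-nadt-upper (24 + k) ,
  f7-nadt-lower (m≤m+n 8 (24 + k))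

theorem36 : (n : ℕ) → 32 ≤ n → Dcc≤ (F7 n) 7 × NADTxor≡ (f7 n) 8
theorem36 n 32≤n =
  let k , 32+k≡n = m≤n⇒∃[o]m+o≡n 32≤n
  in subst (λ n → Dcc≤ (F7 n) 7 × NADTxor≡ (f7 n) 8) 32+k≡n (f7-separation k)
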